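{- For all $k\in\mathbb{N}$ and all integers $m\ge 2^k$, $$\mu(2^{k+1}-1,m)=\mu^*(2^{k+1}-1,2^k)=2^k.$$
   Context: $\mathbb{F}_2$ is the field with two elements. For $u\in\mathbb{F}_2^n$, $|u|$ is the number of entries of $u$ equal to $1$. For an $n\times n$ matrix $W$ over $\mathbb{F}_2$, $M(W,0)=\max\{|Wx| : x\in\mathbb{F}_2^n\}$. For $n,m\ge 1$, $A(n,m)$ is the set of $n\times n$ matrices over $\mathbb{F}_2$ with all diagonal entries $1$ and every column containing at most $m$ ones; for $n\ge m$, $A^*(n,m)$ is the subset of those in which every column contains exactly $m$ ones. $\mu(n,m)=\min\{M(W,0):W\in A(n,m)\}$ and $\mu^*(n,m)=\min\{M(W,0):W\in A^*(n,m)\}$. -}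

module Defs where

open import Data.Nat using (ℕ; zero; suc; _≤_; _⊔_)
open import Data.Bool using (Bool; true; false; _∧_; _xor_; if_then_else_)
open import Data.Fin using (Fin)
open import Data.Product using (Σ; _×_)
open import Data.List using (List; []; _∷_; map; _++_; foldr)
open import Data.Vec.Functional as VF using (Vector)
open import Relation.Binary.PropositionalEquality using (_≡_)

-- F₂ is represented by Bool (false = 0, true = 1; _xor_ = +, _∧_ = ·).
-- Vectors in F₂^n : Fin n → Bool ; n×n matrices : Fin n → Fin n → Bool (W i j = row i, column j).

Vec₂ : ℕ → Set
Vec₂ n = Vector Bool n

Mat₂ : ℕ → Set
Mat₂ n = Fin n → Fin n → Bool

weight : ∀ {n} → Vec₂ n → ℕ
weight u = VF.foldr (λ b acc → if b then suc acc else acc) 0 u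

_·_ : ∀ {n} → Mat₂ n → Vec₂ n → Vec₂ n
(W · x) i = VF.foldr _xor_ false (λ j → W i j ∧ x j)

allVecs : (n : ℕ) → List (Vec₂ n)
allVecs zero = (λ ()) ∷ []
allVecs (suc n) = map (VF._∷_ false) (allVecs n) ++ map (VF._∷_ true) (allVecs n)

M₀ : ∀ {n} → Mat₂ n → ℕ
M₀ {n} W = foldr (λ x acc → weight (W · x) ⊔ acc) 0 (allVecs n)

colWeight : ∀ {n} → Mat₂ n → Fin n → ℕ
colWeight W j = weight (λ i → W i j)

InA : (n m : ℕ) → Mat₂ n → Set
InA n m W = (∀ i → W i i ≡ true) × (∀ j → colWeight W j ≤ m)

InA* : (n m : ℕ) → Mat₂ n → Set
InA* n m W = (∀ i → W i i ≡ true) × (∀ j → colWeight W j ≡ m)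

IsMinM : (n : ℕ) → (Mat₂ n → Set) → ℕ → Set
IsMinM n P v = Σ (Mat₂ n) (λ W → P W × M₀ W ≡ v) × (∀ W → P W → v ≤ M₀ W)

IsMu : (n m v : ℕ) → Set
IsMu n m v = IsMinM n (InA n m) v

IsMu* : (n m v : ℕ) → Set
IsMu* n m v = IsMinM n (InA* n m) v

-- Lower bound: a row of W with a 1 on the diagonal is a nonzero linear form, so (Wx)ᵢ = 1 for
-- exactly half of all x ∈ F₂ⁿ. Summing over i and x, the average of |Wx| is n/2, whence
-- 2 M(W,0) ≥ n = 2^(k+1) − 1 and M(W,0) ≥ 2ᵏ.
-- Upper bound: starting from [1], replace W by the (2n+1)×(2n+1) matrix with row blocks
-- [W | 0], [0 | 1], [W | 1] (constant blocks; the new columns number n + 1). This keeps the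
-- diagonal 1 and doubles every column weight, and for x = (y, z) the new product has weight
-- 2|Wy| if z has even parity and n + 1 otherwise. After k steps the matrix has size 2^(k+1) − 1,
-- all column weights 2ᵏ and M(W,0) ≤ 2ᵏ.

module Submission where

open import Defs
open import Data.Nat using (ℕ; zero; suc; _+_; _*_; _^_; _∸_; _≤_; _⊔_; z≤n; s≤s)
open import Data.Nat.Properties
open import Data.Bool using (Bool; true; false; not; _∧_; _xor_; if_then_else_)
open import Data.Bool.Properties using (∧-zeroʳ; ∧-identityʳ; xor-identityʳ; xor-comm; xor-assoc)
open import Data.Fin using (Fin; zero; suc; _↑ˡ_; _↑ʳ_)
open import Data.List as List using (List; []; _∷_; map; length; foldr)
open import Data.List.Properties using (map-++; map-∘; map-cong; length-++; length-map)
open import Data.Nat.ListAction using (sum)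
open import Data.Nat.ListAction.Properties using (sum-++)
open import Data.Vec.Functional as VF using (_++_) renaming (_∷_ to _∷ᵥ_)
open import Data.Vec.Functional.Properties using (lookup-++ˡ; lookup-++ʳ)
import Data.Vec.Functional.Relation.Binary.Pointwise.Properties as Pointwise
open import Algebra.Properties.Semiring.Sum +-*-semiring
  using (sum-syntax; ∑-distrib-+; *-distribˡ-sum; sum-cong-≗; sum-replicate-zero) renaming (sum to ∑)
open import Data.Product using (_×_; _,_)
open import Function using (_∘_)
open import Algebra.Properties.CommutativeSemigroup +-commutativeSemigroup using () renaming (interchange to +-interchange)
open import Relation.Binary.PropositionalEquality

𝟙 : Bool → ℕ
𝟙 true = 1
𝟙 false = 0

parity : ∀ {n} → Vec₂ n → Bool
parity = VF.foldr _xor_ false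

dot : ∀ {n} → Vec₂ n → Vec₂ n → Bool
dot u v = parity (λ j → u j ∧ v j)

zeros ones : ∀ {n} → Vec₂ n
zeros _ = false
ones _ = true

data SplitView (a b : ℕ) : Fin (a + b) → Set where
  inl : ∀ i → SplitView a b (i ↑ˡ b)
  inr : ∀ j → SplitView a b (a ↑ʳ j)

splitView : ∀ a {b} (i : Fin (a + b)) → SplitView a b i
splitView zero i = inr i
splitView (suc a) zero = inl zero
splitView (suc a) (suc i) with splitView a i
... | inl j = inl (suc j)
... | inr j = inr j

weight-suc : ∀ {n} (u : Vec₂ (suc n)) → weight u ≡ 𝟙 (u zero) + weight (u ∘ suc)
weight-suc u with u zero
... | true = refl
... | false = refl

weight-cong : ∀ {n} {u v : Vec₂ n} → (∀ i → u i ≡ v i) → weight u ≡ weight v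
weight-cong = Pointwise.foldr-cong {R = _≡_} {S = _≡_} (cong₂ λ b acc → if b then suc acc else acc) refl

parity-cong : ∀ {n} {u v : Vec₂ n} → (∀ i → u i ≡ v i) → parity u ≡ parity v
parity-cong = Pointwise.foldr-cong {R = _≡_} {S = _≡_} (cong₂ _xor_) refl

weight≡∑ : ∀ {n} (u : Vec₂ n) → weight u ≡ ∑[ i < n ] 𝟙 (u i)
weight≡∑ {zero} u = refl
weight≡∑ {suc n} u = trans (weight-suc u) (cong (𝟙 (u zero) +_) (weight≡∑ (u ∘ suc)))

weight≤length : ∀ {n} (u : Vec₂ n) → weight u ≤ n
weight≤length {zero} u = z≤n
weight≤length {suc n} u with u zero
... | true = s≤s (weight≤length (u ∘ suc))
... | false = m≤n⇒m≤1+n (weight≤length (u ∘ suc))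

weight-zeros : ∀ n → weight (zeros {n}) ≡ 0
weight-zeros zero = refl
weight-zeros (suc n) = weight-zeros n

weight-ones : ∀ n → weight (ones {n}) ≡ n
weight-ones zero = refl
weight-ones (suc n) = cong suc (weight-ones n)

weight-+-weight-flip : ∀ {n} (u : Vec₂ n) → weight u + weight (λ i → u i xor true) ≡ n
weight-+-weight-flip {zero} u = refl
weight-+-weight-flip {suc n} u with u zero
... | true = cong suc (weight-+-weight-flip (u ∘ suc))
... | false = trans (+-suc _ _) (cong suc (weight-+-weight-flip (u ∘ suc)))

weight-split : ∀ a {b} (u : Vec₂ (a + b)) → weight u ≡ weight (u ∘ (_↑ˡ b)) + weight (u ∘ (a ↑ʳ_))
weight-split zero u = refl
weight-split (suc a) {b} u = begin
  weight u                                                     ≡⟨ weight-suc u ⟩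
  𝟙 (u zero) + weight (u ∘ suc)                                ≡⟨ cong (𝟙 (u zero) +_) (weight-split a (u ∘ suc)) ⟩
  𝟙 (u zero) + (weight (u ∘ suc ∘ (_↑ˡ b)) + weight (u ∘ (suc a ↑ʳ_))) ≡⟨ sym (+-assoc (𝟙 (u zero)) _ _) ⟩
  (𝟙 (u zero) + weight (u ∘ suc ∘ (_↑ˡ b))) + weight (u ∘ (suc a ↑ʳ_)) ≡⟨ cong (_+ weight (u ∘ (suc a ↑ʳ_))) (sym (weight-suc (u ∘ (_↑ˡ b)))) ⟩
  weight (u ∘ (_↑ˡ b)) + weight (u ∘ (suc a ↑ʳ_))              ∎
  where open ≡-Reasoning

weight-blocks : ∀ n (u : Vec₂ (n + suc n)) →
  weight u ≡ weight (u ∘ (_↑ˡ suc n)) + (𝟙 (u (n ↑ʳ zero)) + weight (λ i → u (n ↑ʳ suc i)))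
weight-blocks n u = trans (weight-split n u) (cong (weight (u ∘ (_↑ˡ suc n)) +_) (weight-suc (u ∘ (n ↑ʳ_))))

parity-split : ∀ a {b} (u : Vec₂ (a + b)) → parity u ≡ parity (u ∘ (_↑ˡ b)) xor parity (u ∘ (a ↑ʳ_))
parity-split zero u = refl
parity-split (suc a) u = trans (cong (u zero xor_) (parity-split a (u ∘ suc))) (sym (xor-assoc (u zero) _ _))

dot-zeros : ∀ {n} (v : Vec₂ n) → dot zeros v ≡ false
dot-zeros {zero} v = refl
dot-zeros {suc n} v = dot-zeros (v ∘ suc)

dot-++ : ∀ {a b} (u : Vec₂ a) (v : Vec₂ b) (x : Vec₂ (a + b)) →
         dot (u ++ v) x ≡ dot u (x ∘ (_↑ˡ b)) xor dot v (x ∘ (a ↑ʳ_))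
dot-++ {a} u v x = trans (parity-split a _)
  (cong₂ _xor_ (parity-cong λ j → cong (_∧ x (j ↑ˡ _)) (lookup-++ˡ u v j))
               (parity-cong λ j → cong (_∧ x (a ↑ʳ j)) (lookup-++ʳ u v j)))

module _ {A : Set} where

  sum-map-+ : ∀ (f g : A → ℕ) xs →
              sum (map (λ x → f x + g x) xs) ≡ sum (map f xs) + sum (map g xs)
  sum-map-+ f g [] = refl
  sum-map-+ f g (x ∷ xs) =
    trans (cong (f x + g x +_) (sum-map-+ f g xs)) (+-interchange (f x) (g x) _ _)

  sum-map-const : ∀ c (xs : List A) → sum (map (λ _ → c) xs) ≡ length xs * c
  sum-map-const c [] = refl
  sum-map-const c (x ∷ xs) = cong (c +_) (sum-map-const c xs)

  sum-map-∑-comm : ∀ {m} (g : A → Fin m → ℕ) xs →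
                   sum (map (λ x → ∑[ i < m ] g x i) xs) ≡ ∑[ i < m ] sum (map (λ x → g x i) xs)
  sum-map-∑-comm {m} g [] = sym (sum-replicate-zero m)
  sum-map-∑-comm g (x ∷ xs) =
    trans (cong (∑ (g x) +_) (sum-map-∑-comm g xs)) (sym (∑-distrib-+ (g x) _))

  maximum : (A → ℕ) → List A → ℕ
  maximum f = foldr (λ x acc → f x ⊔ acc) 0

  sum-map≤length*maximum : ∀ (f : A → ℕ) xs → sum (map f xs) ≤ length xs * maximum f xs
  sum-map≤length*maximum f [] = z≤n
  sum-map≤length*maximum f (x ∷ xs) = +-mono-≤ (m≤m⊔n (f x) _)
    (≤-trans (sum-map≤length*maximum f xs) (*-monoʳ-≤ (length xs) (m≤n⊔m (f x) _)))

  maximum-lub : ∀ (f : A → ℕ) {c} → (∀ x → f x ≤ c) → ∀ xs → maximum f xs ≤ c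
  maximum-lub f f≤c [] = z≤n
  maximum-lub f f≤c (x ∷ xs) = ⊔-lub (f≤c x) (maximum-lub f f≤c xs)

∑ᵥ : ∀ n → (Vec₂ n → ℕ) → ℕ
∑ᵥ n f = sum (map f (allVecs n))

length-allVecs : ∀ n → length (allVecs n) ≡ 2 ^ n
length-allVecs zero = refl
length-allVecs (suc n) = begin
  length (map (false ∷ᵥ_) (allVecs n) List.++ map (true ∷ᵥ_) (allVecs n)) ≡⟨ length-++ (map (false ∷ᵥ_) (allVecs n)) ⟩
  length (map (false ∷ᵥ_) (allVecs n)) + length (map (true ∷ᵥ_) (allVecs n)) ≡⟨ cong₂ _+_ (length-map _ (allVecs n)) (length-map _ (allVecs n)) ⟩
  length (allVecs n) + length (allVecs n)                                      ≡⟨ cong₂ _+_ (length-allVecs n) (trans (length-allVecs n) (sym (+-identityʳ _))) ⟩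
  2 ^ suc n                                                                    ∎
  where open ≡-Reasoning

∑ᵥ-suc : ∀ n (f : Vec₂ (suc n) → ℕ) → ∑ᵥ (suc n) f ≡ ∑ᵥ n (f ∘ (false ∷ᵥ_)) + ∑ᵥ n (f ∘ (true ∷ᵥ_))
∑ᵥ-suc n f = begin
  sum (map f (map (false ∷ᵥ_) (allVecs n) List.++ map (true ∷ᵥ_) (allVecs n)))       ≡⟨ cong sum (map-++ f (map (false ∷ᵥ_) (allVecs n)) _) ⟩
  sum (map f (map (false ∷ᵥ_) (allVecs n)) List.++ map f (map (true ∷ᵥ_) (allVecs n))) ≡⟨ sum-++ (map f (map (false ∷ᵥ_) (allVecs n))) _ ⟩
  sum (map f (map (false ∷ᵥ_) (allVecs n))) + sum (map f (map (true ∷ᵥ_) (allVecs n))) ≡⟨ sym (cong₂ _+_ (cong sum (map-∘ (allVecs n))) (cong sum (map-∘ (allVecs n)))) ⟩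
  ∑ᵥ n (f ∘ (false ∷ᵥ_)) + ∑ᵥ n (f ∘ (true ∷ᵥ_))                                          ∎
  where open ≡-Reasoning

∑ᵥ-cong : ∀ {n} {f g : Vec₂ n → ℕ} → (∀ x → f x ≡ g x) → ∑ᵥ n f ≡ ∑ᵥ n g
∑ᵥ-cong {n} f≗g = cong sum (map-cong f≗g (allVecs n))

𝟙-xor-+-𝟙-not-xor : ∀ d b → 𝟙 (d xor b) + 𝟙 (not d xor b) ≡ 1
𝟙-xor-+-𝟙-not-xor true true = refl
𝟙-xor-+-𝟙-not-xor true false = refl
𝟙-xor-+-𝟙-not-xor false true = refl
𝟙-xor-+-𝟙-not-xor false false = refl

-- The shift b is what makes the induction go through: fixing x₀ turns a linear form into an affine one.
affine-balanced : ∀ {n} (c : Vec₂ n) (p : Fin n) → c p ≡ true →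
                  ∀ b → 2 * ∑ᵥ n (λ x → 𝟙 (dot c x xor b)) ≡ 2 ^ n
affine-balanced {suc n} c zero c₀≡true b = begin
  2 * ∑ᵥ (suc n) f                                      ≡⟨ cong (2 *_) (∑ᵥ-suc n f) ⟩
  2 * (∑ᵥ n (f ∘ (false ∷ᵥ_)) + ∑ᵥ n (f ∘ (true ∷ᵥ_))) ≡⟨ cong (2 *_) (sym (sum-map-+ _ _ (allVecs n))) ⟩
  2 * ∑ᵥ n (λ x → f (false ∷ᵥ x) + f (true ∷ᵥ x))       ≡⟨ cong (2 *_) (∑ᵥ-cong pair) ⟩
  2 * ∑ᵥ n (λ _ → 1)                                    ≡⟨ cong (2 *_) (trans (sum-map-const 1 (allVecs n)) (cong (_* 1) (length-allVecs n))) ⟩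
  2 * (2 ^ n * 1)                                       ≡⟨ cong (2 *_) (*-identityʳ (2 ^ n)) ⟩
  2 ^ suc n                                             ∎
  where
  open ≡-Reasoning
  f : Vec₂ (suc n) → ℕ
  f x = 𝟙 (dot c x xor b)
  pair : ∀ x → f (false ∷ᵥ x) + f (true ∷ᵥ x) ≡ 1
  pair x rewrite c₀≡true = 𝟙-xor-+-𝟙-not-xor (dot (c ∘ suc) x) b
affine-balanced {suc n} c (suc p) cₚ≡true b = begin
  2 * ∑ᵥ (suc n) f                                      ≡⟨ cong (2 *_) (∑ᵥ-suc n f) ⟩
  2 * (∑ᵥ n (f ∘ (false ∷ᵥ_)) + ∑ᵥ n (f ∘ (true ∷ᵥ_))) ≡⟨ cong (2 *_) (cong₂ _+_ (∑ᵥ-cong f-false) (∑ᵥ-cong f-true)) ⟩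
  2 * (∑ᵥ n (g b) + ∑ᵥ n (g (c zero xor b)))            ≡⟨ *-distribˡ-+ 2 (∑ᵥ n (g b)) _ ⟩
  2 * ∑ᵥ n (g b) + 2 * ∑ᵥ n (g (c zero xor b))          ≡⟨ cong₂ _+_ (affine-balanced (c ∘ suc) p cₚ≡true b)
                                                                      (affine-balanced (c ∘ suc) p cₚ≡true (c zero xor b)) ⟩
  2 ^ n + 2 ^ n                                         ≡⟨ cong (2 ^ n +_) (sym (+-identityʳ (2 ^ n))) ⟩
  2 ^ suc n                                             ∎
  where
  open ≡-Reasoning
  f : Vec₂ (suc n) → ℕ
  f x = 𝟙 (dot c x xor b)
  g : Bool → Vec₂ n → ℕ
  g b′ x = 𝟙 (dot (c ∘ suc) x xor b′)
  f-false : ∀ x → f (false ∷ᵥ x) ≡ g b x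
  f-false x = cong (λ a → 𝟙 ((a xor dot (c ∘ suc) x) xor b)) (∧-zeroʳ (c zero))
  f-true : ∀ x → f (true ∷ᵥ x) ≡ g (c zero xor b) x
  f-true x = cong 𝟙 (begin
    ((c zero ∧ true) xor d) xor b ≡⟨ cong (λ a → (a xor d) xor b) (∧-identityʳ (c zero)) ⟩
    (c zero xor d) xor b          ≡⟨ cong (_xor b) (xor-comm (c zero) d) ⟩
    (d xor c zero) xor b          ≡⟨ xor-assoc d (c zero) b ⟩
    d xor (c zero xor b)          ∎)
    where d = dot (c ∘ suc) x

∑-const : ∀ n c → ∑[ i < n ] c ≡ n * c
∑-const zero c = refl
∑-const (suc n) c = cong (c +_) (∑-const n c)

∑ᵥ-weight-· : ∀ {n} (W : Mat₂ n) → (∀ i → W i i ≡ true) → 2 * ∑ᵥ n (λ x → weight (W · x)) ≡ n * 2 ^ n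
∑ᵥ-weight-· {n} W diag = begin
  2 * ∑ᵥ n (λ x → weight (W · x))                   ≡⟨ cong (2 *_) (∑ᵥ-cong (λ x → weight≡∑ (W · x))) ⟩
  2 * ∑ᵥ n (λ x → ∑[ i < n ] 𝟙 ((W · x) i))          ≡⟨ cong (2 *_) (sum-map-∑-comm (λ x i → 𝟙 ((W · x) i)) (allVecs n)) ⟩
  2 * ∑[ i < n ] ∑ᵥ n (λ x → 𝟙 ((W · x) i))          ≡⟨ *-distribˡ-sum 2 (λ i → ∑ᵥ n (λ x → 𝟙 ((W · x) i))) ⟩
  ∑[ i < n ] (2 * ∑ᵥ n (λ x → 𝟙 ((W · x) i)))        ≡⟨ sum-cong-≗ row-balanced ⟩
  ∑[ i < n ] (2 ^ n)                                ≡⟨ ∑-const n (2 ^ n) ⟩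
  n * 2 ^ n                                         ∎
  where
  open ≡-Reasoning
  row-balanced : ∀ i → 2 * ∑ᵥ n (λ x → 𝟙 ((W · x) i)) ≡ 2 ^ n
  row-balanced i = trans (cong (2 *_) (∑ᵥ-cong λ x → cong 𝟙 (sym (xor-identityʳ (dot (W i) x)))))
                         (affine-balanced (W i) i (diag i) false)

n≤2*M₀ : ∀ {n} (W : Mat₂ n) → (∀ i → W i i ≡ true) → n ≤ 2 * M₀ W
n≤2*M₀ {n} W diag = *-cancelʳ-≤ n (2 * M₀ W) (2 ^ n) {{m^n≢0 2 n}}
  (subst₂ _≤_ (∑ᵥ-weight-· W diag) rearrange (*-monoʳ-≤ 2 (sum-map≤length*maximum _ (allVecs n))))
  where
  open ≡-Reasoning
  rearrange : 2 * (length (allVecs n) * M₀ W) ≡ 2 * M₀ W * 2 ^ n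
  rearrange = begin
    2 * (length (allVecs n) * M₀ W) ≡⟨ cong (λ l → 2 * (l * M₀ W)) (length-allVecs n) ⟩
    2 * (2 ^ n * M₀ W)              ≡⟨ cong (2 *_) (*-comm (2 ^ n) (M₀ W)) ⟩
    2 * (M₀ W * 2 ^ n)              ≡⟨ sym (*-assoc 2 (M₀ W) (2 ^ n)) ⟩
    2 * M₀ W * 2 ^ n                ∎

≤-halve : ∀ k {n M} → suc n ≡ 2 ^ suc k → n ≤ 2 * M → 2 ^ k ≤ M
≤-halve k {n} {M} 1+n≡2^1+k n≤2M = ≮⇒≥ λ M<2^k → 1+n≰n (begin
  2 + 2 * M   ≡⟨ sym (*-suc 2 M) ⟩
  2 * suc M   ≤⟨ *-monoʳ-≤ 2 M<2^k ⟩
  2 ^ suc k   ≡⟨ sym 1+n≡2^1+k ⟩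
  suc n       ≤⟨ s≤s n≤2M ⟩
  1 + 2 * M   ∎)
  where open ≤-Reasoning

upperRows : ∀ {n} → Mat₂ n → Fin n → Vec₂ (n + suc n)
upperRows {n} W i = W i ++ zeros {suc n}

lowerRows : ∀ {n} → Mat₂ n → Fin (suc n) → Vec₂ (n + suc n)
lowerRows {n} W = (zeros {n} ++ ones {suc n}) ∷ᵥ λ i → W i ++ ones {suc n}

double : ∀ {n} → Mat₂ n → Mat₂ (n + suc n)
double W = upperRows W ++ lowerRows W

module _ {n} (W : Mat₂ n) where

  double-top : ∀ i → double W (i ↑ˡ suc n) ≡ W i ++ zeros {suc n}
  double-top = lookup-++ˡ (upperRows W) (lowerRows W)

  double-mid : double W (n ↑ʳ zero) ≡ zeros {n} ++ ones {suc n}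
  double-mid = lookup-++ʳ (upperRows W) (lowerRows W) zero

  double-bot : ∀ i → double W (n ↑ʳ suc i) ≡ W i ++ ones {suc n}
  double-bot i = lookup-++ʳ (upperRows W) (lowerRows W) (suc i)

  double-diag : (∀ i → W i i ≡ true) → ∀ i → double W i i ≡ true
  double-diag diag i with splitView n i
  ... | inl i = trans (cong-app (double-top i) _) (trans (lookup-++ˡ (W i) (zeros {suc n}) i) (diag i))
  ... | inr zero = trans (cong-app double-mid _) (lookup-++ʳ (zeros {n}) (ones {suc n}) zero)
  ... | inr (suc i) = trans (cong-app (double-bot i) _) (lookup-++ʳ (W i) (ones {suc n}) (suc i))

  weight-∘-double : ∀ (f : Vec₂ (n + suc n) → Bool) →
    weight (f ∘ double W) ≡ weight (f ∘ upperRows W) + (𝟙 (f (zeros {n} ++ ones {suc n})) + weight (λ i → f (W i ++ ones)))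
  weight-∘-double f = trans (weight-blocks n (f ∘ double W))
    (cong₂ _+_ (weight-cong λ i → cong f (double-top i))
               (cong₂ _+_ (cong (𝟙 ∘ f) double-mid) (weight-cong λ i → cong f (double-bot i))))

  double-colWeight : ∀ {c} → (∀ j → colWeight W j ≡ c) → suc n ≡ 2 * c →
                     ∀ j → colWeight (double W) j ≡ 2 * c
  double-colWeight {c} col 1+n≡2c j with splitView n j
  ... | inl j = begin
    colWeight (double W) (j ↑ˡ suc n)   ≡⟨ weight-∘-double (λ row → row (j ↑ˡ suc n)) ⟩
    _                                   ≡⟨ cong₂ _+_ (weight-cong λ i → lookup-++ˡ (W i) (zeros {suc n}) j)
                                                     (cong₂ _+_ (cong 𝟙 (lookup-++ˡ (zeros {n}) (ones {suc n}) j))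
                                                                (weight-cong λ i → lookup-++ˡ (W i) (ones {suc n}) j)) ⟩
    colWeight W j + (0 + colWeight W j) ≡⟨ cong₂ _+_ (col j) (col j) ⟩
    c + c                               ≡⟨ cong (c +_) (sym (+-identityʳ c)) ⟩
    2 * c                               ∎
    where open ≡-Reasoning
  ... | inr j = begin
    colWeight (double W) (n ↑ʳ j)       ≡⟨ weight-∘-double (λ row → row (n ↑ʳ j)) ⟩
    _                                   ≡⟨ cong₂ _+_ (weight-cong λ i → lookup-++ʳ (W i) (zeros {suc n}) j)
                                                     (cong₂ _+_ (cong 𝟙 (lookup-++ʳ (zeros {n}) (ones {suc n}) j))
                                                                (weight-cong λ i → lookup-++ʳ (W i) (ones {suc n}) j)) ⟩
    weight (zeros {n}) + suc (weight (ones {n})) ≡⟨ cong₂ (λ a b → a + suc b) (weight-zeros n) (weight-ones n) ⟩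
    suc n                               ≡⟨ 1+n≡2c ⟩
    2 * c                               ∎
    where open ≡-Reasoning

  weight-double-· : ∀ x → let y = x ∘ (_↑ˡ suc n) ; p = parity (x ∘ (n ↑ʳ_)) in
    weight (double W · x) ≡ weight (W · y) + (𝟙 p + weight (λ i → (W · y) i xor p))
  weight-double-· x = trans (weight-∘-double (λ row → dot row x))
    (cong₂ _+_ (weight-cong upper) (cong₂ _+_ (cong 𝟙 middle) (weight-cong λ i → dot-++ (W i) ones x)))
    where
    y = x ∘ (_↑ˡ suc n)
    z = x ∘ (n ↑ʳ_)
    upper : ∀ i → dot (W i ++ zeros {suc n}) x ≡ (W · y) i
    upper i = trans (dot-++ (W i) zeros x) (trans (cong (dot (W i) y xor_) (dot-zeros z)) (xor-identityʳ _))
    middle : dot (zeros {n} ++ ones {suc n}) x ≡ parity z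
    middle = trans (dot-++ (zeros {n}) (ones {suc n}) x) (cong (_xor parity z) (dot-zeros y))

weight-+-weight-xor-≤ : ∀ {n c} (u : Vec₂ n) p → weight u ≤ c → suc n ≡ 2 * c →
                        weight u + (𝟙 p + weight (λ i → u i xor p)) ≤ 2 * c
weight-+-weight-xor-≤ {c = c} u false u≤c _ = begin
  weight u + weight (λ i → u i xor false) ≡⟨ cong (weight u +_) (weight-cong λ i → xor-identityʳ (u i)) ⟩
  weight u + weight u                     ≤⟨ +-mono-≤ u≤c u≤c ⟩
  c + c                                   ≡⟨ cong (c +_) (sym (+-identityʳ c)) ⟩
  2 * c                                   ∎
  where open ≤-Reasoning
weight-+-weight-xor-≤ u true _ 1+n≡2c =
  ≤-reflexive (trans (+-suc (weight u) _) (trans (cong suc (weight-+-weight-flip u)) 1+n≡2c))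

double-·-≤ : ∀ {n c} (W : Mat₂ n) → (∀ y → weight (W · y) ≤ c) → suc n ≡ 2 * c →
             ∀ x → weight (double W · x) ≤ 2 * c
double-·-≤ {n} W W≤c 1+n≡2c x = ≤-trans (≤-reflexive (weight-double-· W x))
  (weight-+-weight-xor-≤ (W · (x ∘ (_↑ˡ suc n))) _ (W≤c _) 1+n≡2c)

dim : ℕ → ℕ
dim zero = 1
dim (suc k) = dim k + suc (dim k)

suc-dim : ∀ k → suc (dim k) ≡ 2 ^ suc k
suc-dim zero = refl
suc-dim (suc k) = cong₂ _+_ (suc-dim k) (trans (suc-dim k) (sym (+-identityʳ _)))

optimal : ∀ k → Mat₂ (dim k)
optimal zero = λ _ _ → true
optimal (suc k) = double (optimal k)

optimal-diag : ∀ k i → optimal k i i ≡ true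
optimal-diag zero i = refl
optimal-diag (suc k) = double-diag (optimal k) (optimal-diag k)

optimal-colWeight : ∀ k j → colWeight (optimal k) j ≡ 2 ^ k
optimal-colWeight zero j = refl
optimal-colWeight (suc k) = double-colWeight (optimal k) (optimal-colWeight k) (suc-dim k)

optimal-·-≤ : ∀ k x → weight (optimal k · x) ≤ 2 ^ k
optimal-·-≤ zero x = weight≤length (optimal zero · x)
optimal-·-≤ (suc k) = double-·-≤ (optimal k) (optimal-·-≤ k) (suc-dim k)

theorem3p3 : (k m : ℕ) → 2 ^ k ≤ m →
    IsMu (2 ^ suc k ∸ 1) m (2 ^ k) × IsMu* (2 ^ suc k ∸ 1) (2 ^ k) (2 ^ k)
theorem3p3 k m 2^k≤m =
  subst (λ n → IsMu n m (2 ^ k) × IsMu* n (2 ^ k) (2 ^ k)) (cong (_∸ 1) (suc-dim k))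
    ( ((W , (optimal-diag k , λ j → subst (_≤ m) (sym (optimal-colWeight k j)) 2^k≤m) , M₀W≡2^k) , minimal)
    , ((W , (optimal-diag k , optimal-colWeight k) , M₀W≡2^k) , minimal) )
  where
  W = optimal k
  lower : ∀ V → (∀ i → V i i ≡ true) → 2 ^ k ≤ M₀ V
  lower V diag = ≤-halve k (suc-dim k) (n≤2*M₀ V diag)
  minimal : ∀ {Cols : Mat₂ (dim k) → Set} V → (∀ i → V i i ≡ true) × Cols V → 2 ^ k ≤ M₀ V
  minimal V (diag , _) = lower V diag
  M₀W≡2^k : M₀ W ≡ 2 ^ k
  M₀W≡2^k = ≤-antisym (maximum-lub _ (optimal-·-≤ k) (allVecs (dim k))) (lower W (optimal-diag k))
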